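{- Let $k\ge 2$ and let $a\le b\le c\le d$ be numbers written on four distinct sheets of the starting configuration. Suppose that either there is an optimal $k$-step strategy in which Alice plays $(a,c)$ and $(b,d)$ in the first two steps, or there is an optimal $k$-step strategy in which Alice plays $(a,d)$ and $(b,c)$ in the first two steps. Then there exists an optimal $k$-step strategy in which Alice plays $(a,b)$ in the first step and $(c,d)$ in the second step.
   Context: One-player game: Alice has $n$ sheets of paper, each with a positive integer written on it. A move consists of choosing two sheets, with numbers $a$ and $b$, erasing them and writing $a+b$ on both sheets; this move is denoted $(a,b)$. The configuration is the multiset of the numbers on the sheets. $opt(S,k)$ is the smallest possible sum of the numbers after exactly $k$ moves starting from configuration $S$. An optimal $k$-step strategy is a sequence of $k$ moves from the starting configuration after which the sum equals $opt(S,k)$. -}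

module Defs where

open import Data.Nat using (ℕ; _+_; _≤_)
open import Data.Fin using (Fin)
open import Data.Vec using (Vec; lookup; _[_]≔_; sum)
open import Data.List using (List; []; _∷_; length)
open import Data.Product using (Σ; _×_; _,_; proj₁; proj₂)
open import Relation.Binary.PropositionalEquality using (_≡_; _≢_)

Config : ℕ → Set
Config n = Vec ℕ n

Move : ℕ → Set
Move n = Σ (Fin n × Fin n) (λ p → proj₁ p ≢ proj₂ p)

mv : ∀ {n} (i j : Fin n) → i ≢ j → Move n
mv i j p = (i , j) , p

applyMove : ∀ {n} → Config n → Move n → Config n
applyMove S ((i , j) , _) =
  let s = lookup S i + lookup S j in (S [ i ]≔ s) [ j ]≔ s

play : ∀ {n} → Config n → List (Move n) → Config n
play S []       = S
play S (m ∷ ms) = play (applyMove S m) ms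

total : ∀ {n} → Config n → ℕ
total = sum

Positive : ∀ {n} → Config n → Set
Positive {n} S = (i : Fin n) → 1 ≤ lookup S i

OptimalStrategy : ∀ {n} → Config n → ℕ → List (Move n) → Set
OptimalStrategy {n} S k ms =
  length ms ≡ k ×
  ((ms' : List (Move n)) → length ms' ≡ k → total (play S ms) ≤ total (play S ms'))

-- Playing a fixed list of moves is linear in the starting configuration and
-- commutes with relabelling the sheets.  After (a,c),(b,d) the sheets of a,c
-- carry a+c and those of b,d carry b+d; after (a,b),(c,d) they carry a+b and
-- c+d.  With α = d − a and β = c − b we have (α + β)(a+c) = α(a+b) + β(c+d)
-- and (α + β)(b+d) = α(c+d) + β(a+b), so (α + β) times the first configuration
-- is a nonnegative combination of two relabellings of the second.  Hence for
-- one of the two relabellings, the relabelled continuation after (a,b),(c,d)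
-- costs no more than the given optimal continuation after (a,c),(b,d).  The
-- case (a,d),(b,c) is the same argument with the roles of c and d exchanged.
module Submission where

open import Defs
open import Data.Nat using (ℕ; zero; suc; _+_; _*_; _≤_; _<_; _≤?_; z≤n; s≤s; >-nonZero)
open import Data.Nat.Properties
  using (+-comm; *-zeroʳ; ≤-trans; ≤-reflexive; <⇒≱; ≰⇒>; m≤n+m; n<1+n; *-distribʳ-+;
         *-monoʳ-<; *-monoʳ-≤; +-mono-≤; m≤n⇒∃[o]m+o≡n; +-0-commutativeMonoid; module ≤-Reasoning)
open import Data.Nat.Tactic.RingSolver using (solve-∀)
open import Data.Fin using (Fin; _≟_)
open import Data.Fin.Permutation using (Permutation′; _⟨$⟩ʳ_; transpose)
open import Data.Vec using (Vec; []; _∷_; lookup; _[_]≔_; tabulate; zipWith)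
open import Data.Vec.Properties using (lookup∘update; lookup∘update′; lookup∘tabulate; lookup-zipWith; tabulate∘lookup; tabulate-cong)
open import Data.List using (List; []; _∷_; length; map)
open import Data.List.Properties using (length-map)
open import Data.Product using (Σ; _×_; _,_)
open import Data.Sum using (_⊎_; inj₁; inj₂)
import Data.Sum as Sum
import Data.Product as Product
open import Function.Bundles using (Injection)
open import Function.Properties.Inverse using (↔⇒↣)
open import Relation.Nullary using (yes; no; contradiction)
open import Relation.Nullary.Decidable using (dec-true; dec-false)
open import Relation.Binary.PropositionalEquality
  using (_≡_; _≢_; _≗_; refl; sym; trans; cong; cong₂; ≢-sym; module ≡-Reasoning)
open import Algebra.Properties.CommutativeMonoid.Sum +-0-commutativeMonoid
  using (sum-permute; sum-cong-≗) renaming (sum to ∑)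

private
  variable
    n : ℕ

≗⇒≡ : {Z W : Vec ℕ n} → lookup Z ≗ lookup W → Z ≡ W
≗⇒≡ {Z = Z} {W} eq = trans (sym (tabulate∘lookup Z)) (trans (tabulate-cong eq) (tabulate∘lookup W))

weighted-cong : ∀ α β {x x′ y y′} → x ≡ x′ → y ≡ y′ → α * x + β * y ≡ α * x′ + β * y′
weighted-cong α β = cong₂ (λ u v → α * u + β * v)

data Touched (i j x : Fin n) : Set where
  touched   : x ≡ i ⊎ x ≡ j → Touched i j x
  untouched : x ≢ i → x ≢ j → Touched i j x

touched? : (i j x : Fin n) → Touched i j x
touched? i j x with x ≟ i | x ≟ j
... | yes x≡i | _       = touched (inj₁ x≡i)
... | no _    | yes x≡j = touched (inj₂ x≡j)
... | no x≢i  | no x≢j  = untouched x≢i x≢j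

lookup∘applyMove : (Z : Config n) {i j x : Fin n} (i≢j : i ≢ j) → x ≡ i ⊎ x ≡ j →
  lookup (applyMove Z (mv i j i≢j)) x ≡ lookup Z i + lookup Z j
lookup∘applyMove Z {i} i≢j (inj₁ refl) = trans (lookup∘update′ i≢j (Z [ i ]≔ _) _) (lookup∘update i Z _)
lookup∘applyMove Z {i} {j} i≢j (inj₂ refl) = lookup∘update j (Z [ i ]≔ _) _

lookup∘applyMove′ : (Z : Config n) {i j x : Fin n} (i≢j : i ≢ j) → x ≢ i → x ≢ j →
  lookup (applyMove Z (mv i j i≢j)) x ≡ lookup Z x
lookup∘applyMove′ Z {i} i≢j x≢i x≢j = trans (lookup∘update′ x≢j (Z [ i ]≔ _) _) (lookup∘update′ x≢i Z _)

applyMove-sym : (Z : Config n) {i j : Fin n} (i≢j : i ≢ j) (j≢i : j ≢ i) →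
  applyMove Z (mv i j i≢j) ≡ applyMove Z (mv j i j≢i)
applyMove-sym Z {i} {j} i≢j j≢i = ≗⇒≡ pointwise
  where
  pointwise : ∀ x → lookup (applyMove Z (mv i j i≢j)) x ≡ lookup (applyMove Z (mv j i j≢i)) x
  pointwise x with touched? i j x
  ... | touched x∈ = trans (lookup∘applyMove Z i≢j x∈)
    (trans (+-comm (lookup Z i) (lookup Z j)) (sym (lookup∘applyMove Z j≢i (Sum.swap x∈))))
  ... | untouched x≢i x≢j = trans (lookup∘applyMove′ Z i≢j x≢i x≢j) (sym (lookup∘applyMove′ Z j≢i x≢j x≢i))

weighted-+ : ∀ α β z w z′ w′ → (α * z + β * w) + (α * z′ + β * w′) ≡ α * (z + z′) + β * (w + w′)
weighted-+ = solve-∀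

lincomb : ℕ → ℕ → Config n → Config n → Config n
lincomb α β = zipWith (λ x y → α * x + β * y)

applyMove-lincomb : ∀ α β (Z W : Config n) (m : Move n) →
  applyMove (lincomb α β Z W) m ≡ lincomb α β (applyMove Z m) (applyMove W m)
applyMove-lincomb α β Z W ((i , j) , i≢j) = ≗⇒≡ pointwise
  where
  V = lincomb α β Z W
  pointwise : ∀ x → lookup (applyMove V (mv i j i≢j)) x
                  ≡ lookup (lincomb α β (applyMove Z (mv i j i≢j)) (applyMove W (mv i j i≢j))) x
  pointwise x with touched? i j x
  ... | touched x∈ = begin
    lookup (applyMove V (mv i j i≢j)) x
      ≡⟨ lookup∘applyMove V i≢j x∈ ⟩
    lookup V i + lookup V j
      ≡⟨ cong₂ _+_ (lookup-zipWith _ i Z W) (lookup-zipWith _ j Z W) ⟩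
    (α * lookup Z i + β * lookup W i) + (α * lookup Z j + β * lookup W j)
      ≡⟨ weighted-+ α β (lookup Z i) (lookup W i) (lookup Z j) (lookup W j) ⟩
    α * (lookup Z i + lookup Z j) + β * (lookup W i + lookup W j)
      ≡⟨ weighted-cong α β (lookup∘applyMove Z i≢j x∈) (lookup∘applyMove W i≢j x∈) ⟨
    α * lookup (applyMove Z (mv i j i≢j)) x + β * lookup (applyMove W (mv i j i≢j)) x
      ≡⟨ lookup-zipWith _ x (applyMove Z (mv i j i≢j)) (applyMove W (mv i j i≢j)) ⟨
    lookup (lincomb α β (applyMove Z (mv i j i≢j)) (applyMove W (mv i j i≢j))) x ∎
    where open ≡-Reasoning
  ... | untouched x≢i x≢j = begin
    lookup (applyMove V (mv i j i≢j)) x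
      ≡⟨ lookup∘applyMove′ V i≢j x≢i x≢j ⟩
    lookup V x
      ≡⟨ lookup-zipWith _ x Z W ⟩
    α * lookup Z x + β * lookup W x
      ≡⟨ weighted-cong α β (lookup∘applyMove′ Z i≢j x≢i x≢j) (lookup∘applyMove′ W i≢j x≢i x≢j) ⟨
    α * lookup (applyMove Z (mv i j i≢j)) x + β * lookup (applyMove W (mv i j i≢j)) x
      ≡⟨ lookup-zipWith _ x (applyMove Z (mv i j i≢j)) (applyMove W (mv i j i≢j)) ⟨
    lookup (lincomb α β (applyMove Z (mv i j i≢j)) (applyMove W (mv i j i≢j))) x ∎
    where open ≡-Reasoning

play-lincomb : ∀ α β (Z W : Config n) (ms : List (Move n)) →
  play (lincomb α β Z W) ms ≡ lincomb α β (play Z ms) (play W ms)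
play-lincomb α β Z W []       = refl
play-lincomb α β Z W (m ∷ ms) =
  trans (cong (λ V → play V ms) (applyMove-lincomb α β Z W m)) (play-lincomb α β _ _ ms)

total-lincomb : ∀ α β (Z W : Config n) → total (lincomb α β Z W) ≡ α * total Z + β * total W
total-lincomb α β []       []       = sym (cong₂ _+_ (*-zeroʳ α) (*-zeroʳ β))
total-lincomb α β (z ∷ Z) (w ∷ W) =
  trans (cong (α * z + β * w +_) (total-lincomb α β Z W)) (weighted-+ α β z w (total Z) (total W))

relabel : Permutation′ n → Config n → Config n
relabel π Z = tabulate (λ x → lookup Z (π ⟨$⟩ʳ x))

permute-≢ : (π : Permutation′ n) {x y : Fin n} → x ≢ y → π ⟨$⟩ʳ x ≢ π ⟨$⟩ʳ y
permute-≢ π x≢y πx≡πy = x≢y (Injection.injective (↔⇒↣ π) πx≡πy)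

relabelMove : Permutation′ n → Move n → Move n
relabelMove π ((i , j) , i≢j) = (π ⟨$⟩ʳ i , π ⟨$⟩ʳ j) , permute-≢ π i≢j

applyMove-relabel : (π : Permutation′ n) (Z : Config n) (m : Move n) →
  applyMove (relabel π Z) m ≡ relabel π (applyMove Z (relabelMove π m))
applyMove-relabel π Z m@((i , j) , i≢j) = ≗⇒≡ pointwise
  where
  π· = π ⟨$⟩ʳ_
  πm = relabelMove π m
  pointwise : ∀ x → lookup (applyMove (relabel π Z) m) x ≡ lookup (relabel π (applyMove Z πm)) x
  pointwise x with touched? i j x
  ... | touched x∈ = begin
    lookup (applyMove (relabel π Z) m) x
      ≡⟨ lookup∘applyMove (relabel π Z) i≢j x∈ ⟩
    lookup (relabel π Z) i + lookup (relabel π Z) j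
      ≡⟨ cong₂ _+_ (lookup∘tabulate _ i) (lookup∘tabulate _ j) ⟩
    lookup Z (π· i) + lookup Z (π· j)
      ≡⟨ lookup∘applyMove Z (permute-≢ π i≢j) (Sum.map (cong π·) (cong π·) x∈) ⟨
    lookup (applyMove Z πm) (π· x)
      ≡⟨ lookup∘tabulate _ x ⟨
    lookup (relabel π (applyMove Z πm)) x ∎
    where open ≡-Reasoning
  ... | untouched x≢i x≢j = begin
    lookup (applyMove (relabel π Z) m) x
      ≡⟨ lookup∘applyMove′ (relabel π Z) i≢j x≢i x≢j ⟩
    lookup (relabel π Z) x
      ≡⟨ lookup∘tabulate _ x ⟩
    lookup Z (π· x)
      ≡⟨ lookup∘applyMove′ Z (permute-≢ π i≢j) (permute-≢ π x≢i) (permute-≢ π x≢j) ⟨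
    lookup (applyMove Z πm) (π· x)
      ≡⟨ lookup∘tabulate _ x ⟨
    lookup (relabel π (applyMove Z πm)) x ∎
    where open ≡-Reasoning

play-relabel : (π : Permutation′ n) (Z : Config n) (ms : List (Move n)) →
  play (relabel π Z) ms ≡ relabel π (play Z (map (relabelMove π) ms))
play-relabel π Z []       = refl
play-relabel π Z (m ∷ ms) =
  trans (cong (λ V → play V ms) (applyMove-relabel π Z m)) (play-relabel π _ ms)

total≡∑lookup : (Z : Config n) → total Z ≡ ∑ (lookup Z)
total≡∑lookup []      = refl
total≡∑lookup (z ∷ Z) = cong (z +_) (total≡∑lookup Z)

total-relabel : (π : Permutation′ n) (Z : Config n) → total (relabel π Z) ≡ total Z
total-relabel π Z = begin
  total (relabel π Z)            ≡⟨ total≡∑lookup (relabel π Z) ⟩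
  ∑ (lookup (relabel π Z))       ≡⟨ sum-cong-≗ (lookup∘tabulate (λ x → lookup Z (π ⟨$⟩ʳ x))) ⟩
  ∑ (λ x → lookup Z (π ⟨$⟩ʳ x))  ≡⟨ sum-permute (lookup Z) π ⟨
  ∑ (lookup Z)                   ≡⟨ total≡∑lookup Z ⟨
  total Z                        ∎
  where open ≡-Reasoning

total-play-relabel : (π : Permutation′ n) (Z : Config n) (ms : List (Move n)) →
  total (play (relabel π Z) ms) ≡ total (play Z (map (relabelMove π) ms))
total-play-relabel π Z ms =
  trans (cong total (play-relabel π Z ms)) (total-relabel π (play Z (map (relabelMove π) ms)))

weighted-mean-≤ : ∀ α β F A B → 1 ≤ α + β → α * F + β * F ≡ α * A + β * B → A ≤ F ⊎ B ≤ F
weighted-mean-≤ α β F A B _ _ with A ≤? F | B ≤? F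
... | yes A≤F | _       = inj₁ A≤F
... | no _    | yes B≤F = inj₂ B≤F
weighted-mean-≤ α β F A B 1≤α+β balance | no A≰F | no B≰F =
  contradiction (≤-reflexive (sym balance)) (<⇒≱ mean<)
  where
  open ≤-Reasoning
  mean< : α * F + β * F < α * A + β * B
  mean< = begin-strict
    α * F + β * F      ≡⟨ *-distribʳ-+ F α β ⟨
    (α + β) * F        <⟨ *-monoʳ-< (α + β) {{>-nonZero 1≤α+β}} (n<1+n F) ⟩
    (α + β) * suc F    ≡⟨ *-distribʳ-+ (suc F) α β ⟩
    α * suc F + β * suc F ≤⟨ +-mono-≤ (*-monoʳ-≤ α (≰⇒> A≰F)) (*-monoʳ-≤ β (≰⇒> B≰F)) ⟩
    α * A + β * B      ∎

averaging : (X Y : Config n) (σ τ : Permutation′ n) (α β : ℕ) → 1 ≤ α + β →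
  lincomb α β X X ≡ lincomb α β (relabel σ Y) (relabel τ Y) →
  (ms : List (Move n)) →
  Σ (List (Move n)) λ ms′ → length ms′ ≡ length ms × total (play Y ms′) ≤ total (play X ms)
averaging X Y σ τ α β 1≤α+β X≡Y ms
  with weighted-mean-≤ α β (total (play X ms)) (total (play Y σms)) (total (play Y τms)) 1≤α+β balance
  where
  σms = map (relabelMove σ) ms
  τms = map (relabelMove τ) ms
  open ≡-Reasoning
  balance : α * total (play X ms) + β * total (play X ms) ≡ α * total (play Y σms) + β * total (play Y τms)
  balance = begin
    α * total (play X ms) + β * total (play X ms)
      ≡⟨ total-lincomb α β (play X ms) (play X ms) ⟨
    total (lincomb α β (play X ms) (play X ms))
      ≡⟨ cong total (play-lincomb α β X X ms) ⟨
    total (play (lincomb α β X X) ms)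
      ≡⟨ cong (λ V → total (play V ms)) X≡Y ⟩
    total (play (lincomb α β (relabel σ Y) (relabel τ Y)) ms)
      ≡⟨ cong total (play-lincomb α β (relabel σ Y) (relabel τ Y) ms) ⟩
    total (lincomb α β (play (relabel σ Y) ms) (play (relabel τ Y) ms))
      ≡⟨ total-lincomb α β (play (relabel σ Y) ms) (play (relabel τ Y) ms) ⟩
    α * total (play (relabel σ Y) ms) + β * total (play (relabel τ Y) ms)
      ≡⟨ weighted-cong α β (total-play-relabel σ Y ms) (total-play-relabel τ Y ms) ⟩
    α * total (play Y σms) + β * total (play Y τms) ∎
... | inj₁ ≤F = map (relabelMove σ) ms , length-map (relabelMove σ) ms , ≤F
... | inj₂ ≤F = map (relabelMove τ) ms , length-map (relabelMove τ) ms , ≤F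

transpose-atˡ : (i j : Fin n) → transpose i j ⟨$⟩ʳ i ≡ j
transpose-atˡ i j rewrite dec-true (i ≟ i) refl = refl

transpose-atʳ : {i j : Fin n} → i ≢ j → transpose i j ⟨$⟩ʳ j ≡ i
transpose-atʳ {i = i} {j} i≢j rewrite dec-false (j ≟ i) (≢-sym i≢j) | dec-true (j ≟ j) refl = refl

transpose-elsewhere : {i j x : Fin n} → x ≢ i → x ≢ j → transpose i j ⟨$⟩ʳ x ≡ x
transpose-elsewhere {i = i} {j} {x} x≢i x≢j rewrite dec-false (x ≟ i) x≢i | dec-false (x ≟ j) x≢j = refl

module _ (Z : Config n) {i j k l : Fin n} (i≢j : i ≢ j) (k≢l : k ≢ l) where

  private
    T = applyMove (applyMove Z (mv i j i≢j)) (mv k l k≢l)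

  lookup∘applyMove₂-first : {x : Fin n} → x ≡ i ⊎ x ≡ j → x ≢ k → x ≢ l →
    lookup T x ≡ lookup Z i + lookup Z j
  lookup∘applyMove₂-first x∈ x≢k x≢l =
    trans (lookup∘applyMove′ (applyMove Z (mv i j i≢j)) k≢l x≢k x≢l) (lookup∘applyMove Z i≢j x∈)

  lookup∘applyMove₂-second : {x : Fin n} → k ≢ i → k ≢ j → l ≢ i → l ≢ j → x ≡ k ⊎ x ≡ l →
    lookup T x ≡ lookup Z k + lookup Z l
  lookup∘applyMove₂-second k≢i k≢j l≢i l≢j x∈ =
    trans (lookup∘applyMove (applyMove Z (mv i j i≢j)) k≢l x∈)
          (cong₂ _+_ (lookup∘applyMove′ Z i≢j k≢i k≢j) (lookup∘applyMove′ Z i≢j l≢i l≢j))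

  lookup∘applyMove₂-elsewhere : {x : Fin n} → x ≢ i → x ≢ j → x ≢ k → x ≢ l →
    lookup T x ≡ lookup Z x
  lookup∘applyMove₂-elsewhere x≢i x≢j x≢k x≢l =
    trans (lookup∘applyMove′ (applyMove Z (mv i j i≢j)) k≢l x≢k x≢l) (lookup∘applyMove′ Z i≢j x≢i x≢j)

-- The weights are proportional to (d − a, c − b); if c = b the second
-- configuration is already a relabelling of the first, so (1, 0) works.
regrouping-weights : ∀ {a b c d} → a ≤ d → b ≤ c →
  Σ ℕ λ α → Σ ℕ λ β → 1 ≤ α + β ×
    α * (a + c) + β * (a + c) ≡ α * (a + b) + β * (c + d) ×
    α * (b + d) + β * (b + d) ≡ α * (c + d) + β * (a + b)
regrouping-weights {a} {b} a≤d b≤c with m≤n⇒∃[o]m+o≡n a≤d | m≤n⇒∃[o]m+o≡n b≤c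
... | δ , refl | zero , refl = 1 , 0 , s≤s z≤n , balance₁ a b δ , balance₂ a b δ
  where
  balance₁ : ∀ a b δ → 1 * (a + (b + 0)) + 0 * (a + (b + 0)) ≡ 1 * (a + b) + 0 * ((b + 0) + (a + δ))
  balance₁ = solve-∀
  balance₂ : ∀ a b δ → 1 * (b + (a + δ)) + 0 * (b + (a + δ)) ≡ 1 * ((b + 0) + (a + δ)) + 0 * (a + b)
  balance₂ = solve-∀
... | δ , refl | suc γ , refl =
  δ , suc γ , ≤-trans (s≤s z≤n) (m≤n+m (suc γ) δ) , balance₁ a b δ (suc γ) , balance₂ a b δ (suc γ)
  where
  balance₁ : ∀ a b δ γ → δ * (a + (b + γ)) + γ * (a + (b + γ)) ≡ δ * (a + b) + γ * ((b + γ) + (a + δ))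
  balance₁ = solve-∀
  balance₂ : ∀ a b δ γ → δ * (b + (a + δ)) + γ * (b + (a + δ)) ≡ δ * ((b + γ) + (a + δ)) + γ * (a + b)
  balance₂ = solve-∀

optimal-≤ : {S : Config n} {k : ℕ} (ms ms′ : List (Move n)) → OptimalStrategy S k ms →
  length ms′ ≡ length ms → total (play S ms′) ≤ total (play S ms) → OptimalStrategy S k ms′
optimal-≤ ms ms′ (length≡k , best) same-length ≤ms =
  trans same-length length≡k , λ ms″ l → ≤-trans ≤ms (best ms″ l)

optimal-flip-second : (S : Config n) {k : ℕ} (m : Move n) {i j : Fin n} (i≢j : i ≢ j) (j≢i : j ≢ i)
  (rest : List (Move n)) → OptimalStrategy S k (m ∷ mv i j i≢j ∷ rest) → OptimalStrategy S k (m ∷ mv j i j≢i ∷ rest)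
optimal-flip-second S m i≢j j≢i rest opt =
  optimal-≤ (m ∷ mv _ _ i≢j ∷ rest) (m ∷ mv _ _ j≢i ∷ rest) opt refl
  (≤-reflexive (cong (λ Z → total (play Z rest)) (applyMove-sym (applyMove S m) j≢i i≢j)))

data Among (p q r s x : Fin n) : Set where
  at-p : x ≡ p → Among p q r s x
  at-q : x ≡ q → Among p q r s x
  at-r : x ≡ r → Among p q r s x
  at-s : x ≡ s → Among p q r s x
  elsewhere : x ≢ p → x ≢ q → x ≢ r → x ≢ s → Among p q r s x

among? : (p q r s x : Fin n) → Among p q r s x
among? p q r s x with x ≟ p | x ≟ q | x ≟ r | x ≟ s
... | yes x≡p | _       | _       | _       = at-p x≡p
... | no _    | yes x≡q | _       | _       = at-q x≡q
... | no _    | no _    | yes x≡r | _       = at-r x≡r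
... | no _    | no _    | no _    | yes x≡s = at-s x≡s
... | no x≢p  | no x≢q  | no x≢r  | no x≢s  = elsewhere x≢p x≢q x≢r x≢s

module Regrouping (S : Config n) {p q r s : Fin n}
  (p≢q : p ≢ q) (p≢r : p ≢ r) (p≢s : p ≢ s) (q≢r : q ≢ r) (q≢s : q ≢ s) (r≢s : r ≢ s) where

  private
    a = lookup S p
    b = lookup S q
    c = lookup S r
    d = lookup S s
    crossed = applyMove (applyMove S (mv p r p≢r)) (mv q s q≢s)
    paired  = applyMove (applyMove S (mv p q p≢q)) (mv r s r≢s)
    σ = transpose q r
    τ = transpose p s

  -- relabel σ paired carries a+b on {p,r} and c+d on {q,s}; relabel τ paired the other way round.
  crossed-balanced : ∀ α β →
    α * (a + c) + β * (a + c) ≡ α * (a + b) + β * (c + d) →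
    α * (b + d) + β * (b + d) ≡ α * (c + d) + β * (a + b) →
    lincomb α β crossed crossed ≡ lincomb α β (relabel σ paired) (relabel τ paired)
  crossed-balanced α β E₁ E₂ = ≗⇒≡ λ x → begin
    lookup (lincomb α β crossed crossed) x
      ≡⟨ lookup-zipWith _ x crossed crossed ⟩
    α * lookup crossed x + β * lookup crossed x
      ≡⟨ at x (among? p q r s x) ⟩
    α * lookup paired (σ ⟨$⟩ʳ x) + β * lookup paired (τ ⟨$⟩ʳ x)
      ≡⟨ weighted-cong α β (lookup∘tabulate _ x) (lookup∘tabulate _ x) ⟨
    α * lookup (relabel σ paired) x + β * lookup (relabel τ paired) x
      ≡⟨ lookup-zipWith _ x (relabel σ paired) (relabel τ paired) ⟨
    lookup (lincomb α β (relabel σ paired) (relabel τ paired)) x ∎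
    where
    open ≡-Reasoning
    crossed-first : ∀ {x} → x ≡ p ⊎ x ≡ r → x ≢ q → x ≢ s → lookup crossed x ≡ a + c
    crossed-first = lookup∘applyMove₂-first S p≢r q≢s
    crossed-second : ∀ {x} → x ≡ q ⊎ x ≡ s → lookup crossed x ≡ b + d
    crossed-second = lookup∘applyMove₂-second S p≢r q≢s (≢-sym p≢q) q≢r (≢-sym p≢s) (≢-sym r≢s)
    paired-first : ∀ {x} → x ≡ p ⊎ x ≡ q → x ≢ r → x ≢ s → lookup paired x ≡ a + b
    paired-first = lookup∘applyMove₂-first S p≢q r≢s
    paired-second : ∀ {x} → x ≡ r ⊎ x ≡ s → lookup paired x ≡ c + d
    paired-second = lookup∘applyMove₂-second S p≢q r≢s (≢-sym p≢r) (≢-sym q≢r) (≢-sym p≢s) (≢-sym q≢s)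

    weigh : ∀ {x u v w y z} → lookup crossed x ≡ u →
      σ ⟨$⟩ʳ x ≡ y → lookup paired y ≡ v → τ ⟨$⟩ʳ x ≡ z → lookup paired z ≡ w →
      α * u + β * u ≡ α * v + β * w →
      α * lookup crossed x + β * lookup crossed x ≡ α * lookup paired (σ ⟨$⟩ʳ x) + β * lookup paired (τ ⟨$⟩ʳ x)
    weigh crossed≡u refl paired≡v refl paired≡w E =
      trans (weighted-cong α β crossed≡u crossed≡u) (trans E (sym (weighted-cong α β paired≡v paired≡w)))

    at : ∀ x → Among p q r s x →
      α * lookup crossed x + β * lookup crossed x ≡ α * lookup paired (σ ⟨$⟩ʳ x) + β * lookup paired (τ ⟨$⟩ʳ x)
    at x (at-p refl) = weigh (crossed-first (inj₁ refl) p≢q p≢s)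
      (transpose-elsewhere p≢q p≢r) (paired-first (inj₁ refl) p≢r p≢s)
      (transpose-atˡ p s) (paired-second (inj₂ refl)) E₁
    at x (at-q refl) = weigh (crossed-second (inj₁ refl))
      (transpose-atˡ q r) (paired-second (inj₁ refl))
      (transpose-elsewhere (≢-sym p≢q) q≢s) (paired-first (inj₂ refl) q≢r q≢s) E₂
    at x (at-r refl) = weigh (crossed-first (inj₂ refl) (≢-sym q≢r) r≢s)
      (transpose-atʳ q≢r) (paired-first (inj₂ refl) q≢r q≢s)
      (transpose-elsewhere (≢-sym p≢r) r≢s) (paired-second (inj₁ refl)) E₁
    at x (at-s refl) = weigh (crossed-second (inj₂ refl))
      (transpose-elsewhere (≢-sym q≢s) (≢-sym r≢s)) (paired-second (inj₂ refl))
      (transpose-atʳ p≢s) (paired-first (inj₁ refl) p≢r p≢s) E₂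
    at x (elsewhere x≢p x≢q x≢r x≢s) = weigh (lookup∘applyMove₂-elsewhere S p≢r q≢s x≢p x≢r x≢q x≢s)
      (transpose-elsewhere x≢q x≢r) (lookup∘applyMove₂-elsewhere S p≢q r≢s x≢p x≢q x≢r x≢s)
      (transpose-elsewhere x≢p x≢s) (lookup∘applyMove₂-elsewhere S p≢q r≢s x≢p x≢q x≢r x≢s) refl

  optimal : a ≤ d → b ≤ c → {k : ℕ} →
    Σ (List (Move n)) (λ rest → OptimalStrategy S k (mv p r p≢r ∷ mv q s q≢s ∷ rest)) →
    Σ (List (Move n)) (λ rest → OptimalStrategy S k (mv p q p≢q ∷ mv r s r≢s ∷ rest))
  optimal a≤d b≤c (rest , opt) with regrouping-weights a≤d b≤c
  ... | α , β , 1≤α+β , E₁ , E₂ with averaging crossed paired σ τ α β 1≤α+β (crossed-balanced α β E₁ E₂) rest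
  ... | rest′ , same-length , ≤rest = rest′ ,
    optimal-≤ (mv p r p≢r ∷ mv q s q≢s ∷ rest) (mv p q p≢q ∷ mv r s r≢s ∷ rest′) opt
      (cong (λ l → suc (suc l)) same-length) ≤rest

corollary7 : (n : ℕ) (S : Config n) → Positive S → (k : ℕ) → 2 ≤ k →
    (ia ib ic id : Fin n) →
    (ab : ia ≢ ib) (ac : ia ≢ ic) (ad : ia ≢ id) (bc : ib ≢ ic) (bd : ib ≢ id) (cd : ic ≢ id) →
    lookup S ia ≤ lookup S ib → lookup S ib ≤ lookup S ic → lookup S ic ≤ lookup S id →
    (Σ (List (Move n)) (λ rest → OptimalStrategy S k (mv ia ic ac ∷ mv ib id bd ∷ rest))
      ⊎ Σ (List (Move n)) (λ rest → OptimalStrategy S k (mv ia id ad ∷ mv ib ic bc ∷ rest))) →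
    Σ (List (Move n)) (λ rest → OptimalStrategy S k (mv ia ib ab ∷ mv ic id cd ∷ rest))
corollary7 n S _ k _ ia ib ic id ab ac ad bc bd cd a≤b b≤c c≤d (inj₁ strategy) =
  Regrouping.optimal S ab ac ad bc bd cd (≤-trans a≤b (≤-trans b≤c c≤d)) b≤c strategy
corollary7 n S _ k _ ia ib ic id ab ac ad bc bd cd a≤b b≤c c≤d (inj₂ strategy) =
  Product.map₂ (λ {rest} → optimal-flip-second S (mv ia ib ab) (≢-sym cd) cd rest)
    (Regrouping.optimal S ab ad ac bd bc (≢-sym cd) (≤-trans a≤b b≤c) (≤-trans b≤c c≤d) strategy)
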